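{- Let $D=(N,A,s,t)$ be a network and let $a,b\in\widetilde A$ be arcs such that the inequalities $x(a)\ge0$ and $x(b)\ge0$ define facets $F_a$ and $F_b$ of the flow polytope $\mathcal F(D)$ respectively. Then $F_a=F_b$ if and only if $a$ and $b$ belong to the same corridor.
   Context: A network $D=(N,A,s,t)$ consists of a finite set $N$ of nodes, a set $A$ of arcs (ordered pairs of distinct nodes) such that $(N,A)$ is an acyclic directed graph, and designated nodes $s$ (source) and $t$ (sink). Paths are sequences of arcs with pairwise distinct nodes; an $s$--$t$ path starts at $s$ and ends at $t$. For $x\in\mathbb R^A$, $x(B)=\sum_{a\in B}x(a)$; $\delta^\pm(v)$ are the arcs with tail ($+$), resp. head ($-$), $v$. The flow polytope $\mathcal F(D)$ is the set of $x\in\mathbb R^A$ with $x\ge0$, $x(\delta^+(v))-x(\delta^-(v))=0$ for $v\ne s,t$, and $x(\delta^+(s))-x(\delta^-(s))=1$. $\widetilde A$ is the set of arcs lying on at least one $s$--$t$ path; $\widetilde d^-(u)$, $\widetilde d^+(u)$ are the numbers of arcs of $\widetilde A$ with head, resp. tail, $u$. A corridor is a path $(u_1,u_2),\dots,(u_{m-1},u_m)$ with arcs in $\widetilde A$ such that $\widetilde d^-(u_i)=\widetilde d^+(u_i)=1$ for $2\le i\le m-1$ and ($\widetilde d^-(u_1)\ne1$ or $\widetilde d^+(u_1)\ne1$) and ($\widetilde d^-(u_m)\ne1$ or $\widetilde d^+(u_m)\ne1$); each arc of $\widetilde A$ lies in exactly one corridor. A face of a polytope is the polytope itself or its intersection with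 a hyperplane having it on one closed side (possibly empty); an inequality valid on the polytope defines the face where equality holds; a facet is a proper inclusion-maximal face.
   Formalization: The flow polytope $\mathcal F(D)$ is taken in ℚ^A rather than ℝ^A, so its faces and facets consist of rational points and are cut out by hyperplanes with rational coefficients and offsets. -}

module Defs where

open import Data.Nat as ℕ using (ℕ)
open import Data.Fin using (Fin; zero; suc; _≟_)
open import Data.List using (List; []; _∷_; map)
open import Data.List.Membership.Propositional using (_∈_)
open import Data.List.Relation.Unary.All using (All)
open import Data.List.Relation.Unary.Unique.Propositional using (Unique)
open import Data.Rational using (ℚ; 0ℚ; 1ℚ; _+_; _-_; _*_; _≤_)
open import Data.Product using (Σ; ∃; ∃-syntax; _×_; _,_)
open import Data.Sum using (_⊎_)
open import Relation.Nullary using (¬_; yes; no)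
open import Relation.Binary.PropositionalEquality using (_≡_; _≢_)

-- Networks.  Nodes are Fin n, arcs are Fin m with tail/head maps.
-- Arcs are ordered pairs of distinct nodes: tail ≢ head, and the map
-- a ↦ (tail a , head a) is injective (no parallel arcs).

data Walk {n m : ℕ} (tl hd : Fin m → Fin n) : Fin n → Fin n → List (Fin m) → Set where
  []  : ∀ {u} → Walk tl hd u u []
  _∷_ : ∀ {u v a as} → tl a ≡ u → Walk tl hd (hd a) v as → Walk tl hd u v (a ∷ as)

nodesFrom : {n m : ℕ} → (Fin m → Fin n) → Fin n → List (Fin m) → List (Fin n)
nodesFrom hd u as = u ∷ map hd as

record Network : Set where
  field
    n m      : ℕ
    tl hd    : Fin m → Fin n
    s t      : Fin n
    loopless : ∀ a → tl a ≢ hd a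
    simple   : ∀ a b → tl a ≡ tl b → hd a ≡ hd b → a ≡ b
    acyclic  : ∀ v a as → ¬ Walk tl hd v v (a ∷ as)

module _ (D : Network) where
  open Network D

  IsPath : Fin n → Fin n → List (Fin m) → Set
  IsPath u v as = Walk tl hd u v as × Unique (nodesFrom hd u as)

  InÃ : Fin m → Set
  InÃ a = ∃[ as ] (IsPath s t as × a ∈ as)

  ExactlyOne : (Fin m → Set) → Set
  ExactlyOne P = Σ (Fin m) λ a → P a × (∀ b → P b → b ≡ a)

  InDeg1 : Fin n → Set
  InDeg1 u = ExactlyOne (λ a → InÃ a × hd a ≡ u)

  OutDeg1 : Fin n → Set
  OutDeg1 u = ExactlyOne (λ a → InÃ a × tl a ≡ u)

  interior : List (Fin m) → List (Fin n)
  interior []           = []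
  interior (a ∷ [])     = []
  interior (a ∷ b ∷ as) = hd a ∷ interior (b ∷ as)

  IsCorridor : List (Fin m) → Set
  IsCorridor as =
    Σ (Fin n) λ u → Σ (Fin n) λ v →
      IsPath u v as
      × as ≢ []
      × All InÃ as
      × All (λ w → InDeg1 w × OutDeg1 w) (interior as)
      × ¬ (InDeg1 u × OutDeg1 u)
      × ¬ (InDeg1 v × OutDeg1 v)

  SameCorridor : Fin m → Fin m → Set
  SameCorridor a b = ∃[ as ] (IsCorridor as × a ∈ as × b ∈ as)

  Point : Set
  Point = Fin m → ℚ

  sumFin : ∀ {k} → (Fin k → ℚ) → ℚ
  sumFin {ℕ.zero}  f = 0ℚ
  sumFin {ℕ.suc k} f = f zero + sumFin (λ i → f (suc i))

  ifEq : Fin n → Fin n → ℚ → ℚ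
  ifEq p q r with p ≟ q
  ... | yes _ = r
  ... | no  _ = 0ℚ

  outflow : Point → Fin n → ℚ
  outflow x v = sumFin λ a → ifEq (tl a) v (x a)

  inflow : Point → Fin n → ℚ
  inflow x v = sumFin λ a → ifEq (hd a) v (x a)

  InFlowPolytope : Point → Set
  InFlowPolytope x =
    (∀ a → 0ℚ ≤ x a)
    × (∀ v → v ≢ s → v ≢ t → outflow x v - inflow x v ≡ 0ℚ)
    × (outflow x s - inflow x s ≡ 1ℚ)

  _⊆_ : (Point → Set) → (Point → Set) → Set
  F ⊆ G = ∀ x → F x → G x

  _≐_ : (Point → Set) → (Point → Set) → Set
  F ≐ G = (F ⊆ G) × (G ⊆ F)

  dot : Point → Point → ℚ
  dot c x = sumFin λ a → c a * x a

  IsFace : (Point → Set) → Set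
  IsFace F =
    (F ≐ InFlowPolytope)
    ⊎ (Σ Point λ c → Σ ℚ λ δ →
         (∃[ a ] (c a ≢ 0ℚ))
         × (∀ x → InFlowPolytope x → dot c x ≤ δ)
         × (F ≐ (λ x → InFlowPolytope x × dot c x ≡ δ)))

  IsProperFace : (Point → Set) → Set
  IsProperFace F = IsFace F × ¬ (InFlowPolytope ⊆ F)

  IsFacet : (Point → Set) → Set₁
  IsFacet F = IsProperFace F × (∀ G → IsProperFace G → F ⊆ G → G ⊆ F)

  FaceOf : Fin m → Point → Set
  FaceOf a x = InFlowPolytope x × x a ≡ 0ℚ

-- Flow is conserved and arcs outside Ã carry none (weight the nodes by the indicator of the set
-- of nodes reaching the tail, or reached from the head, of such an arc), so the flow is constant
-- along a corridor and arcs of one corridor define the same face.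
-- Conversely, let C be the corridor of a, from u to v. Path vectors show that F_a = F_b makes
-- every s–t path through a meet b and every s–t path through b meet all of C. Continuing C by a
-- path to t, b cannot come after v: v ≠ t has a second entering arc (were the last arc ℓ of C the
-- only one, F_ℓ ⊆ F_c for every arc c leaving v, so F_ℓ = F_c by maximality, which leaves a single
-- such c and makes v an inner node), and entering v by it gives an s–t path through b avoiding ℓ.
-- Symmetrically, b cannot come before u.

module Submission where

open import Defs
open import Data.Nat as ℕ using (zero; suc)
import Data.Nat.Properties as ℕ
open import Data.Fin using (Fin; zero; suc; _≟_)
open import Data.Fin.Properties using (suc-injective; any?; injective⇒≤)
open import Data.List using (List; []; _∷_; _++_; length; lookup)
open import Data.List.Properties using (length-map; length-++; ++-conicalˡ)
open import Data.List.Membership.Propositional using (_∈_; _∉_)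
open import Data.List.Membership.Propositional.Properties using (∈-++⁺ˡ; ∈-++⁺ʳ; ∈-++⁻; ∈-lookup)
import Data.List.Membership.DecPropositional as DecMembership
open import Data.List.Relation.Unary.Any using (here; there)
open import Data.List.Relation.Unary.All as All using (All; []; _∷_)
import Data.List.Relation.Unary.All.Properties as All
open import Data.List.Relation.Unary.AllPairs using ([]; _∷_)
open import Data.List.Relation.Unary.Unique.Propositional using (Unique)
open import Data.Product using (∃; ∃₂; ∃-syntax; _×_; _,_; proj₁; proj₂)
open import Data.Sum using (_⊎_; inj₁; inj₂)
open import Data.Empty using (⊥-elim)
open import Function.Base using (_∘_)
open import Function.Bundles using (_⇔_; mk⇔)
open import Relation.Nullary using (¬_; Dec; yes; no)
open import Relation.Nullary.Decidable using (_×-dec_; ¬?; map′; decidable-stable)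
open import Relation.Unary using (Decidable)
open import Relation.Binary.PropositionalEquality
  using (_≡_; _≢_; refl; sym; trans; cong; cong₂; subst; subst₂; module ≡-Reasoning)
open import Data.Rational using (ℚ; 0ℚ; 1ℚ; _+_; _-_; _*_; -_; _≤_; _<_)
import Data.Rational.Properties as ℚ
open import Data.Rational.Solver using (module +-*-Solver)

open +-*-Solver using (solve; _:+_; _:-_; _:=_)
open ≡-Reasoning

+-≤-≡⇒≡ : ∀ {p q r s : ℚ} → p ≤ r → q ≤ s → p + q ≡ r + s → p ≡ r × q ≡ s
+-≤-≡⇒≡ p≤r q≤s eq =
  ℚ.≤-antisym p≤r (ℚ.≮⇒≥ λ p<r → ℚ.<-irrefl eq (ℚ.+-mono-<-≤ p<r q≤s)) ,
  ℚ.≤-antisym q≤s (ℚ.≮⇒≥ λ q<s → ℚ.<-irrefl eq (ℚ.+-mono-≤-< p≤r q<s))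

χ : ∀ {P : Set} → Dec P → ℚ
χ (yes _) = 1ℚ
χ (no _)  = 0ℚ

χ-yes : ∀ {P : Set} (P? : Dec P) → P → χ P? ≡ 1ℚ
χ-yes (yes _) _ = refl
χ-yes (no ¬p) p = ⊥-elim (¬p p)

χ-no : ∀ {P : Set} (P? : Dec P) → ¬ P → χ P? ≡ 0ℚ
χ-no (yes p) ¬p = ⊥-elim (¬p p)
χ-no (no _)  _  = refl

χ-nonneg : ∀ {P : Set} (P? : Dec P) → 0ℚ ≤ χ P?
χ-nonneg (yes _) = ℚ.nonNegative⁻¹ 1ℚ
χ-nonneg (no _)  = ℚ.≤-refl

χ-*-mono : ∀ {P Q : Set} (P? : Dec P) (Q? : Dec Q) {r} → (P → Q) → 0ℚ ≤ r → χ P? * r ≤ χ Q? * r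
χ-*-mono (yes p) (yes _) _   _   = ℚ.≤-refl
χ-*-mono (yes p) (no ¬q) P⇒Q _   = ⊥-elim (¬q (P⇒Q p))
χ-*-mono (no _)  (yes _) {r} _ 0≤r =
  subst₂ _≤_ (sym (ℚ.*-zeroˡ r)) (sym (ℚ.*-identityˡ r)) 0≤r
χ-*-mono (no _)  (no _)  _   _   = ℚ.≤-refl

χ-*-≡⇒≡0 : ∀ {P Q : Set} (P? : Dec P) (Q? : Dec Q) {r} →
           ¬ P → Q → χ P? * r ≡ χ Q? * r → r ≡ 0ℚ
χ-*-≡⇒≡0 (yes p) _       ¬p _ _  = ⊥-elim (¬p p)
χ-*-≡⇒≡0 (no _)  (no ¬q) _  q _  = ⊥-elim (¬q q)
χ-*-≡⇒≡0 (no _)  (yes _) {r} _ _ eq = begin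
  r          ≡⟨ ℚ.*-identityˡ r ⟨
  1ℚ * r     ≡⟨ eq ⟨
  0ℚ * r     ≡⟨ ℚ.*-zeroˡ r ⟩
  0ℚ         ∎

lookup-injective : ∀ {k} (xs : List (Fin k)) → Unique xs →
                   ∀ {i j} → lookup xs i ≡ lookup xs j → i ≡ j
lookup-injective (x ∷ xs) _          {zero}  {zero}  _  = refl
lookup-injective (x ∷ xs) (x∉xs ∷ _) {zero}  {suc j} eq = ⊥-elim (All.lookup x∉xs (∈-lookup j) eq)
lookup-injective (x ∷ xs) (x∉xs ∷ _) {suc i} {zero}  eq = ⊥-elim (All.lookup x∉xs (∈-lookup i) (sym eq))
lookup-injective (x ∷ xs) (_ ∷ u)    {suc i} {suc j} eq = cong suc (lookup-injective xs u eq)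

unique⇒length≤ : ∀ {k} (xs : List (Fin k)) → Unique xs → length xs ℕ.≤ k
unique⇒length≤ xs u = injective⇒≤ (lookup-injective xs u)

module _ (D : Network) where
  open Network D
  open DecMembership (_≟_ {m}) using (_∈?_)

  private
    W : Fin n → Fin n → List (Fin m) → Set
    W = Walk tl hd

    Ã : Fin m → Set
    Ã = InÃ D

    ∑ : ∀ {k} → (Fin k → ℚ) → ℚ
    ∑ = sumFin D

  -- Walks and reachability

  Reach : Fin n → Fin n → Set
  Reach x y = ∃ (W x y)

  _++ʷ_ : ∀ {x y z A B} → W x y A → W y z B → W x z (A ++ B)
  []      ++ʷ q = q
  (e ∷ p) ++ʷ q = e ∷ (p ++ʷ q)

  reach-trans : ∀ {x y z} → Reach x y → Reach y z → Reach x z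
  reach-trans (A , p) (B , q) = A ++ B , p ++ʷ q

  reach-arc : ∀ e → Reach (tl e) (hd e)
  reach-arc e = e ∷ [] , refl ∷ []

  ¬reach-hd-tl : ∀ e → ¬ Reach (hd e) (tl e)
  ¬reach-hd-tl e (A , p) = acyclic (tl e) e A (refl ∷ p)

  reach-tl : ∀ {x y Z e} → W x y Z → e ∈ Z → Reach x (tl e)
  reach-tl (refl ∷ p) (here refl) = [] , []
  reach-tl (refl ∷ p) (there e∈Z) = reach-trans (reach-arc _) (reach-tl p e∈Z)

  reach-hd : ∀ {x y Z e} → W x y Z → e ∈ Z → Reach (hd e) y
  reach-hd (refl ∷ p) (here refl) = _ , p
  reach-hd (_ ∷ p)    (there e∈Z) = reach-hd p e∈Z

  walk-≢ : ∀ {x y Z e} → W x y Z → e ∈ Z → x ≢ y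
  walk-≢ p e∈Z refl = ¬reach-hd-tl _ (reach-trans (reach-hd p e∈Z) (reach-tl p e∈Z))

  walk⇒path : ∀ {x y Z} → W x y Z → IsPath D x y Z
  walk⇒path p = p , nodes-unique p
    where
    reach-nodes : ∀ {x y Z} → W x y Z → All (Reach x) (nodesFrom hd x Z)
    reach-nodes []         = ([] , []) ∷ []
    reach-nodes (refl ∷ p) = ([] , []) ∷ All.map (reach-trans (reach-arc _)) (reach-nodes p)

    nodes-unique : ∀ {x y Z} → W x y Z → Unique (nodesFrom hd x Z)
    nodes-unique []         = [] ∷ []
    nodes-unique (refl ∷ p) =
      All.map (λ r tl≡w → ¬reach-hd-tl _ (subst (Reach _) (sym tl≡w) r)) (reach-nodes p)
      ∷ nodes-unique p

  walk-length< : ∀ {x y Z} → W x y Z → length Z ℕ.< n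
  walk-length< {Z = Z} p =
    subst (ℕ._≤ n) (cong suc (length-map hd Z)) (unique⇒length≤ _ (proj₂ (walk⇒path p)))

  walk-tl-injective : ∀ {x y Z e e′} → W x y Z → e ∈ Z → e′ ∈ Z → tl e ≡ tl e′ → e ≡ e′
  walk-tl-injective (refl ∷ p) (here refl) (here refl)  _  = refl
  walk-tl-injective (refl ∷ p) (here refl) (there e′∈Z) eq =
    ⊥-elim (¬reach-hd-tl _ (subst (Reach _) (sym eq) (reach-tl p e′∈Z)))
  walk-tl-injective (refl ∷ p) (there e∈Z) (here refl)  eq =
    ⊥-elim (¬reach-hd-tl _ (subst (Reach _) eq (reach-tl p e∈Z)))
  walk-tl-injective (_ ∷ p)    (there e∈Z) (there e′∈Z) eq = walk-tl-injective p e∈Z e′∈Z eq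

  walk-hd-injective : ∀ {x y Z e e′} → W x y Z → e ∈ Z → e′ ∈ Z → hd e ≡ hd e′ → e ≡ e′
  walk-hd-injective (refl ∷ p) (here refl) (here refl)  _  = refl
  walk-hd-injective (refl ∷ p) (here refl) (there e′∈Z) eq =
    ⊥-elim (¬reach-hd-tl _ (subst (λ w → Reach w _) eq (reach-tl p e′∈Z)))
  walk-hd-injective (refl ∷ p) (there e∈Z) (here refl)  eq =
    ⊥-elim (¬reach-hd-tl _ (subst (λ w → Reach w _) (sym eq) (reach-tl p e∈Z)))
  walk-hd-injective (_ ∷ p)    (there e∈Z) (there e′∈Z) eq = walk-hd-injective p e∈Z e′∈Z eq

  first-arc : ∀ {x y Z} → W x y Z → x ≢ y → ∃ λ e → e ∈ Z × tl e ≡ x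
  first-arc []       x≢y = ⊥-elim (x≢y refl)
  first-arc (eq ∷ _) _   = _ , here refl , eq

  last-arc : ∀ {x y Z} → W x y Z → x ≢ y → ∃ λ e → e ∈ Z × hd e ≡ y
  last-arc [] x≢y = ⊥-elim (x≢y refl)
  last-arc {y = y} (_∷_ {a = e} _ p) _ with hd e ≟ y
  ... | yes hd≡y = e , here refl , hd≡y
  ... | no  hd≢y with last-arc p hd≢y
  ...   | e′ , e′∈Z , hd≡ = e′ , there e′∈Z , hd≡

  reach-within? : ∀ k x y → Dec (∃ λ Z → W x y Z × length Z ℕ.≤ k)
  reach-within? k x y with x ≟ y
  ... | yes refl = yes ([] , [] , ℕ.z≤n)
  reach-within? zero x y | no x≢y = no λ { ([] , [] , _) → x≢y refl ; (_ ∷ _ , _ , ()) }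
  reach-within? (suc k) x y | no x≢y with any? (λ e → tl e ≟ x ×-dec reach-within? k (hd e) y)
  ... | yes (e , tl≡x , Z , p , ≤k) = yes (e ∷ Z , tl≡x ∷ p , ℕ.s≤s ≤k)
  ... | no ∄ = no λ
    { ([] , [] , _)                 → x≢y refl
    ; (e ∷ Z , tl≡x ∷ p , ℕ.s≤s ≤k) → ∄ (e , tl≡x , Z , p , ≤k) }

  reach? : ∀ x y → Dec (Reach x y)
  reach? x y = map′ (λ (Z , p , _) → Z , p) (λ (Z , p) → Z , p , ℕ.<⇒≤ (walk-length< p))
                    (reach-within? n x y)

  Ã⇒reach : ∀ {e} → Ã e → Reach s (tl e) × Reach (hd e) t
  Ã⇒reach (_ , (p , _) , e∈Z) = reach-tl p e∈Z , reach-hd p e∈Z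

  Ã⇒reach-st : ∀ {e} → Ã e → Reach s t
  Ã⇒reach-st (Z , (p , _) , _) = Z , p

  st-walk⇒Ã : ∀ {Z e} → W s t Z → e ∈ Z → Ã e
  st-walk⇒Ã p e∈Z = _ , walk⇒path p , e∈Z

  reach⇒Ã : ∀ {e} → Reach s (tl e) → Reach (hd e) t → Ã e
  reach⇒Ã {e} (A , p) (B , q) = st-walk⇒Ã (p ++ʷ (refl ∷ q)) (∈-++⁺ʳ A (here refl))

  walk⇒Ã : ∀ {x y Z e} → W x y Z → Reach s x → Reach y t → e ∈ Z → Ã e
  walk⇒Ã p s⇝x y⇝t e∈Z =
    reach⇒Ã (reach-trans s⇝x (reach-tl p e∈Z)) (reach-trans (reach-hd p e∈Z) y⇝t)

  Ã? : Decidable Ã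
  Ã? e = map′ (λ (r , r′) → reach⇒Ã r r′) Ã⇒reach (reach? s (tl e) ×-dec reach? (hd e) t)

  Ã⇒hd≢s : ∀ {e} → Ã e → hd e ≢ s
  Ã⇒hd≢s {e} ãe hd≡s =
    ¬reach-hd-tl e (subst (λ w → Reach w (tl e)) (sym hd≡s) (proj₁ (Ã⇒reach ãe)))

  Ã⇒tl≢t : ∀ {e} → Ã e → tl e ≢ t
  Ã⇒tl≢t {e} ãe tl≡t =
    ¬reach-hd-tl e (subst (Reach (hd e)) (sym tl≡t) (proj₂ (Ã⇒reach ãe)))

  Ã-successor : ∀ {e} → Ã e → hd e ≢ t → ∃ λ c → Ã c × tl c ≡ hd e
  Ã-successor ãe hd≢t with proj₂ (Ã⇒reach ãe)
  ... | B , q with first-arc q hd≢t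
  ...   | c , c∈B , tl≡ =
    c , walk⇒Ã q (reach-trans (proj₁ (Ã⇒reach ãe)) (reach-arc _)) ([] , []) c∈B , tl≡

  Ã-predecessor : ∀ {e} → Ã e → tl e ≢ s → ∃ λ c → Ã c × hd c ≡ tl e
  Ã-predecessor {e} ãe tl≢s with proj₁ (Ã⇒reach ãe)
  ... | A , p with last-arc p (tl≢s ∘ sym)
  ...   | c , c∈A , hd≡ =
    c , walk⇒Ã p ([] , []) (reach-trans (reach-arc e) (proj₂ (Ã⇒reach ãe))) c∈A , hd≡

  -- Sums and flows

  ∑-cong : ∀ {k} {f g : Fin k → ℚ} → (∀ i → f i ≡ g i) → ∑ f ≡ ∑ g
  ∑-cong {zero}  _   = refl
  ∑-cong {suc k} f≗g = cong₂ _+_ (f≗g zero) (∑-cong (f≗g ∘ suc))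

  ∑-zero : ∀ {k} → ∑ {k} (λ _ → 0ℚ) ≡ 0ℚ
  ∑-zero {zero}  = refl
  ∑-zero {suc k} = cong (0ℚ +_) (∑-zero {k})

  ∑-+ : ∀ {k} (f g : Fin k → ℚ) → ∑ (λ i → f i + g i) ≡ ∑ f + ∑ g
  ∑-+ {zero}  f g = refl
  ∑-+ {suc k} f g = trans (cong (f zero + g zero +_) (∑-+ (f ∘ suc) (g ∘ suc)))
    (solve 4 (λ a b c d → (a :+ b) :+ (c :+ d) := (a :+ c) :+ (b :+ d)) refl (f zero) (g zero) _ _)

  ∑-*ˡ : ∀ {k} c (f : Fin k → ℚ) → ∑ (λ i → c * f i) ≡ c * ∑ f
  ∑-*ˡ {zero}  c f = sym (ℚ.*-zeroʳ c)
  ∑-*ˡ {suc k} c f = trans (cong (c * f zero +_) (∑-*ˡ c (f ∘ suc))) (sym (ℚ.*-distribˡ-+ c (f zero) _))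

  ∑-comm : ∀ {k l} (f : Fin k → Fin l → ℚ) →
           ∑ (λ i → ∑ (f i)) ≡ ∑ (λ j → ∑ (λ i → f i j))
  ∑-comm {zero} {l} f = sym (∑-zero {l})
  ∑-comm {suc k} f = trans (cong (∑ (f zero) +_) (∑-comm (f ∘ suc))) (sym (∑-+ (f zero) _))

  ∑-point : ∀ {k} {f : Fin k → ℚ} p → (∀ i → i ≢ p → f i ≡ 0ℚ) → ∑ f ≡ f p
  ∑-point {suc k} {f} zero    f≡0 =
    trans (cong (f zero +_) (trans (∑-cong (λ i → f≡0 (suc i) λ ())) (∑-zero {k}))) (ℚ.+-identityʳ _)
  ∑-point {suc k} {f} (suc p) f≡0 =
    trans (cong₂ _+_ (f≡0 zero λ ()) (∑-point p λ i i≢p → f≡0 (suc i) (i≢p ∘ suc-injective)))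
          (ℚ.+-identityˡ _)

  ∑-mono-≤ : ∀ {k} {f g : Fin k → ℚ} → (∀ i → f i ≤ g i) → ∑ f ≤ ∑ g
  ∑-mono-≤ {zero}  _   = ℚ.≤-refl
  ∑-mono-≤ {suc k} f≤g = ℚ.+-mono-≤ (f≤g zero) (∑-mono-≤ (f≤g ∘ suc))

  ∑-≤-≡⇒≡ : ∀ {k} {f g : Fin k → ℚ} →
            (∀ i → f i ≤ g i) → ∑ f ≡ ∑ g → ∀ i → f i ≡ g i
  ∑-≤-≡⇒≡ {suc k} f≤g eq zero    =
    proj₁ (+-≤-≡⇒≡ (f≤g zero) (∑-mono-≤ (f≤g ∘ suc)) eq)
  ∑-≤-≡⇒≡ {suc k} f≤g eq (suc i) =
    ∑-≤-≡⇒≡ (f≤g ∘ suc) (proj₂ (+-≤-≡⇒≡ (f≤g zero) (∑-mono-≤ (f≤g ∘ suc)) eq)) i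

  ifEq-≡ : ∀ {p q} r → p ≡ q → ifEq D p q r ≡ r
  ifEq-≡ {p} {q} r p≡q with p ≟ q
  ... | yes _   = refl
  ... | no  p≢q = ⊥-elim (p≢q p≡q)

  ifEq-≢ : ∀ {p q} r → p ≢ q → ifEq D p q r ≡ 0ℚ
  ifEq-≢ {p} {q} r p≢q with p ≟ q
  ... | yes p≡q = ⊥-elim (p≢q p≡q)
  ... | no  _   = refl

  ifEq-0 : ∀ p q → ifEq D p q 0ℚ ≡ 0ℚ
  ifEq-0 p q with p ≟ q
  ... | yes _ = refl
  ... | no  _ = refl

  ifEq-+ : ∀ p q r r′ → ifEq D p q (r + r′) ≡ ifEq D p q r + ifEq D p q r′
  ifEq-+ p q r r′ with p ≟ q
  ... | yes _ = refl
  ... | no  _ = refl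

  ifEq-nonneg : ∀ p q {r} → 0ℚ ≤ r → 0ℚ ≤ ifEq D p q r
  ifEq-nonneg p q 0≤r with p ≟ q
  ... | yes _ = 0≤r
  ... | no  _ = ℚ.≤-refl

  flowAt : (Fin m → Fin n) → Point D → Fin n → ℚ
  flowAt g x w = ∑ (λ a → ifEq D (g a) w (x a))

  ∑-potential : ∀ g x (φ : Fin n → ℚ) →
                ∑ (λ w → φ w * flowAt g x w) ≡ ∑ (λ a → φ (g a) * x a)
  ∑-potential g x φ = begin
    ∑ (λ w → φ w * flowAt g x w)
      ≡⟨ ∑-cong (λ w → ∑-*ˡ (φ w) (λ a → ifEq D (g a) w (x a))) ⟨
    ∑ (λ w → ∑ (λ a → φ w * ifEq D (g a) w (x a)))
      ≡⟨ ∑-comm (λ w a → φ w * ifEq D (g a) w (x a)) ⟩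
    ∑ (λ a → ∑ (λ w → φ w * ifEq D (g a) w (x a)))
      ≡⟨ ∑-cong (λ a → ∑-point (g a) (off-diagonal a)) ⟩
    ∑ (λ a → φ (g a) * ifEq D (g a) (g a) (x a))
      ≡⟨ ∑-cong (λ a → cong (φ (g a) *_) (ifEq-≡ {g a} (x a) refl)) ⟩
    ∑ (λ a → φ (g a) * x a)
      ∎
    where
    off-diagonal : ∀ a w → w ≢ g a → φ w * ifEq D (g a) w (x a) ≡ 0ℚ
    off-diagonal a w w≢ = trans (cong (φ w *_) (ifEq-≢ (x a) (w≢ ∘ sym))) (ℚ.*-zeroʳ (φ w))

  conservation : ∀ {x} → InFlowPolytope D x → ∀ {w} → w ≢ s → w ≢ t → outflow D x w ≡ inflow D x w
  conservation {x} (_ , balanced , _) {w} w≢s w≢t = begin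
    O                ≡⟨ solve 2 (λ O I → O := (O :- I) :+ I) refl O I ⟩
    (O - I) + I      ≡⟨ cong (_+ I) (balanced w w≢s w≢t) ⟩
    0ℚ + I           ≡⟨ ℚ.+-identityˡ I ⟩
    I                ∎
    where O = outflow D x w
          I = inflow D x w

  balanced-potential : ∀ {x} → InFlowPolytope D x → (φ : Fin n → ℚ) → φ s ≡ 0ℚ → φ t ≡ 0ℚ →
                       ∑ (λ a → φ (tl a) * x a) ≡ ∑ (λ a → φ (hd a) * x a)
  balanced-potential {x} x∈P φ φs≡0 φt≡0 = begin
    ∑ (λ a → φ (tl a) * x a)         ≡⟨ ∑-potential tl x φ ⟨
    ∑ (λ w → φ w * outflow D x w)    ≡⟨ ∑-cong balanced-at ⟩
    ∑ (λ w → φ w * inflow D x w)     ≡⟨ ∑-potential hd x φ ⟩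
    ∑ (λ a → φ (hd a) * x a)         ∎
    where
    vanishing : ∀ {w} → φ w ≡ 0ℚ → φ w * outflow D x w ≡ φ w * inflow D x w
    vanishing {w} φw≡0 = begin
      φ w * outflow D x w   ≡⟨ cong (_* outflow D x w) φw≡0 ⟩
      0ℚ * outflow D x w    ≡⟨ ℚ.*-zeroˡ (outflow D x w) ⟩
      0ℚ                    ≡⟨ ℚ.*-zeroˡ (inflow D x w) ⟨
      0ℚ * inflow D x w     ≡⟨ cong (_* inflow D x w) φw≡0 ⟨
      φ w * inflow D x w    ∎

    balanced-at : ∀ w → φ w * outflow D x w ≡ φ w * inflow D x w
    balanced-at w with w ≟ s | w ≟ t
    ... | yes refl | _        = vanishing φs≡0
    ... | no  _    | yes refl = vanishing φt≡0
    ... | no  w≢s  | no  w≢t  = cong (φ w *_) (conservation x∈P w≢s w≢t)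

  -- Weighting nodes by the indicator of S, the flow into S equals the flow out of S.
  module _ {x : Point D} (x∈P : InFlowPolytope D x) {S : Fin n → Set} (S? : Decidable S)
           (s∉S : ¬ S s) (t∉S : ¬ S t) where

    private
      χS-balanced : ∑ (λ a → χ (S? (tl a)) * x a) ≡ ∑ (λ a → χ (S? (hd a)) * x a)
      χS-balanced = balanced-potential x∈P (χ ∘ S?) (χ-no (S? s) s∉S) (χ-no (S? t) t∉S)

    entering-arc-flow≡0 : (∀ a → S (tl a) → S (hd a)) →
                          ∀ {e} → ¬ S (tl e) → S (hd e) → x e ≡ 0ℚ
    entering-arc-flow≡0 out-closed {e} tl∉S hd∈S = χ-*-≡⇒≡0 (S? (tl e)) (S? (hd e)) tl∉S hd∈S
      (∑-≤-≡⇒≡ (λ a → χ-*-mono (S? (tl a)) (S? (hd a)) (out-closed a) (proj₁ x∈P a))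
               χS-balanced e)

    leaving-arc-flow≡0 : (∀ a → S (hd a) → S (tl a)) →
                         ∀ {e} → S (tl e) → ¬ S (hd e) → x e ≡ 0ℚ
    leaving-arc-flow≡0 in-closed {e} tl∈S hd∉S = χ-*-≡⇒≡0 (S? (hd e)) (S? (tl e)) hd∉S tl∈S
      (∑-≤-≡⇒≡ (λ a → χ-*-mono (S? (hd a)) (S? (tl a)) (in-closed a) (proj₁ x∈P a))
               (sym χS-balanced) e)

  flow-outside-Ã : ∀ {x} → InFlowPolytope D x → Reach s t → ∀ {e} → ¬ Ã e → x e ≡ 0ℚ
  flow-outside-Ã x∈P s⇝t {e} e∉Ã with reach? s (tl e)
  ... | no s⇝̸tl =
    leaving-arc-flow≡0 x∈P (λ w → reach? w (tl e)) s⇝̸tl (s⇝̸tl ∘ reach-trans s⇝t)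
      (λ a → reach-trans (reach-arc a)) ([] , []) (¬reach-hd-tl e)
  ... | yes s⇝tl =
    entering-arc-flow≡0 x∈P (reach? (hd e)) (λ hd⇝s → ¬reach-hd-tl e (reach-trans hd⇝s s⇝tl))
      (e∉Ã ∘ reach⇒Ã s⇝tl) (λ a hd⇝tl → reach-trans hd⇝tl (reach-arc a)) (¬reach-hd-tl e) ([] , [])

  flow-through-sole-arc : ∀ {x} → InFlowPolytope D x → Reach s t → ∀ g {w e} →
                          (∀ e′ → Ã e′ × g e′ ≡ w → e′ ≡ e) → g e ≡ w → flowAt g x w ≡ x e
  flow-through-sole-arc {x} x∈P s⇝t g {w} {e} sole ge≡w = trans (∑-point e others) (ifEq-≡ (x e) ge≡w)
    where
    others : ∀ e′ → e′ ≢ e → ifEq D (g e′) w (x e′) ≡ 0ℚ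
    others e′ e′≢e with Ã? e′
    ... | yes ã = ifEq-≢ (x e′) (λ g≡w → e′≢e (sole e′ (ã , g≡w)))
    ... | no ∉Ã = trans (cong (ifEq D (g e′) w) (flow-outside-Ã x∈P s⇝t ∉Ã)) (ifEq-0 (g e′) w)

  flowAt≡0⇒ : ∀ {x} → (∀ a → 0ℚ ≤ x a) →
              ∀ g {w} → flowAt g x w ≡ 0ℚ → ∀ {e} → g e ≡ w → x e ≡ 0ℚ
  flowAt≡0⇒ {x} x≥0 g {w} flow≡0 {e} ge≡w = begin
    x e                   ≡⟨ ifEq-≡ (x e) ge≡w ⟨
    ifEq D (g e) w (x e)  ≡⟨ terms≡0 e ⟨
    0ℚ                    ∎
    where
    terms≡0 = ∑-≤-≡⇒≡ (λ a → ifEq-nonneg (g a) w (x≥0 a)) (trans (∑-zero {m}) (sym flow≡0))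

  -- Path vectors and the faces x(e) = 0

  pathVector : List (Fin m) → Point D
  pathVector []      a = 0ℚ
  pathVector (e ∷ Z) a = χ (e ≟ a) + pathVector Z a

  pathVector-nonneg : ∀ Z a → 0ℚ ≤ pathVector Z a
  pathVector-nonneg []      a = ℚ.≤-refl
  pathVector-nonneg (e ∷ Z) a = ℚ.+-mono-≤ (χ-nonneg (e ≟ a)) (pathVector-nonneg Z a)

  pathVector-∉ : ∀ {Z e} → e ∉ Z → pathVector Z e ≡ 0ℚ
  pathVector-∉ {[]}    _   = refl
  pathVector-∉ {c ∷ Z} e∉Z =
    cong₂ _+_ (χ-no (c ≟ _) (λ c≡e → e∉Z (here (sym c≡e)))) (pathVector-∉ (e∉Z ∘ there))

  pathVector-∈ : ∀ {Z e} → e ∈ Z → pathVector Z e ≢ 0ℚ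
  pathVector-∈ e∈Z pv≡0 = ℚ.<-irrefl (sym pv≡0) (positive e∈Z)
    where
    positive : ∀ {Z e} → e ∈ Z → 0ℚ < pathVector Z e
    positive {e ∷ Z} (here refl) = subst (λ c → 0ℚ < c + pathVector Z e) (sym (χ-yes (e ≟ e) refl))
      (ℚ.+-mono-<-≤ (ℚ.positive⁻¹ 1ℚ) (pathVector-nonneg Z e))
    positive {c ∷ Z} (there e∈Z) = ℚ.+-mono-≤-< (χ-nonneg (c ≟ _)) (positive e∈Z)

  flowAt-+ : ∀ g x y w → flowAt g (λ a → x a + y a) w ≡ flowAt g x w + flowAt g y w
  flowAt-+ g x y w =
    trans (∑-cong (λ a → ifEq-+ (g a) w (x a) (y a)))
          (∑-+ (λ a → ifEq D (g a) w (x a)) (λ a → ifEq D (g a) w (y a)))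

  flowAt-unit : ∀ g e w → flowAt g (λ a → χ (e ≟ a)) w ≡ ifEq D (g e) w 1ℚ
  flowAt-unit g e w = trans (∑-point e off) (cong (ifEq D (g e) w) (χ-yes (e ≟ e) refl))
    where
    off : ∀ a → a ≢ e → ifEq D (g a) w (χ (e ≟ a)) ≡ 0ℚ
    off a a≢e = trans (cong (ifEq D (g a) w) (χ-no (e ≟ a) (a≢e ∘ sym))) (ifEq-0 (g a) w)

  flowAt-zero : ∀ g w → flowAt g (λ _ → 0ℚ) w ≡ 0ℚ
  flowAt-zero g w = trans (∑-cong (λ a → ifEq-0 (g a) w)) (∑-zero {m})

  walk-net-flow : ∀ {u w Z} → W u w Z → ∀ v →
    outflow D (pathVector Z) v - inflow D (pathVector Z) v ≡ ifEq D u v 1ℚ - ifEq D w v 1ℚ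
  walk-net-flow {u} [] v =
    trans (cong₂ _-_ (flowAt-zero tl v) (flowAt-zero hd v)) (sym (ℚ.+-inverseʳ (ifEq D u v 1ℚ)))
  walk-net-flow {w = w} {Z = e ∷ Z} (refl ∷ p) v = begin
    outflow D (pathVector (e ∷ Z)) v - inflow D (pathVector (e ∷ Z)) v
      ≡⟨ cong₂ _-_ (flow-∷ tl) (flow-∷ hd) ⟩
    (U + O) - (H + I)
      ≡⟨ solve 4 (λ U O H I → (U :+ O) :- (H :+ I) := (U :- H) :+ (O :- I)) refl U O H I ⟩
    (U - H) + (O - I)  ≡⟨ cong ((U - H) +_) (walk-net-flow p v) ⟩
    (U - H) + (H - T)  ≡⟨ solve 3 (λ U H T → (U :- H) :+ (H :- T) := U :- T) refl U H T ⟩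
    U - T              ∎
    where
    U = ifEq D (tl e) v 1ℚ
    H = ifEq D (hd e) v 1ℚ
    T = ifEq D w v 1ℚ
    O = outflow D (pathVector Z) v
    I = inflow D (pathVector Z) v
    flow-∷ : ∀ g → flowAt g (pathVector (e ∷ Z)) v ≡ ifEq D (g e) v 1ℚ + flowAt g (pathVector Z) v
    flow-∷ g = trans (flowAt-+ g (λ a → χ (e ≟ a)) (pathVector Z) v)
                     (cong (_+ flowAt g (pathVector Z) v) (flowAt-unit g e v))

  pathVector∈P : ∀ {Z} → W s t Z → s ≢ t → InFlowPolytope D (pathVector Z)
  pathVector∈P {Z} p s≢t = pathVector-nonneg Z , balanced , source
    where
    balanced : ∀ v → v ≢ s → v ≢ t → outflow D (pathVector Z) v - inflow D (pathVector Z) v ≡ 0ℚ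
    balanced v v≢s v≢t =
      trans (walk-net-flow p v) (cong₂ _-_ (ifEq-≢ 1ℚ (v≢s ∘ sym)) (ifEq-≢ 1ℚ (v≢t ∘ sym)))
    source : outflow D (pathVector Z) s - inflow D (pathVector Z) s ≡ 1ℚ
    source = trans (walk-net-flow p s) (cong₂ _-_ (ifEq-≡ {s} 1ℚ refl) (ifEq-≢ 1ℚ (s≢t ∘ sym)))

  face-⊆⇒∈ : ∀ {e f Z} → _⊆_ D (FaceOf D e) (FaceOf D f) → W s t Z → f ∈ Z → e ∈ Z
  face-⊆⇒∈ {e} {f} {Z} Fe⊆Ff p f∈Z with e ∈? Z
  ... | yes e∈Z = e∈Z
  ... | no  e∉Z = ⊥-elim (pathVector-∈ f∈Z
          (proj₂ (Fe⊆Ff (pathVector Z) (pathVector∈P p (walk-≢ p f∈Z) , pathVector-∉ e∉Z))))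

  FaceOf-proper : ∀ {e} → Ã e → IsProperFace D (FaceOf D e)
  FaceOf-proper {e} (Z , (p , _) , e∈Z) =
    inj₂ (c , 0ℚ , (e , c≢0) , valid
         , (λ x (x∈P , x≡0) → x∈P , trans (dot-c x) (cong -_ x≡0))
         , (λ x (x∈P , dot≡0) → x∈P , ℚ.neg-injective (trans (sym (dot-c x)) dot≡0)))
    , λ all → pathVector-∈ e∈Z (proj₂ (all (pathVector Z) (pathVector∈P p (walk-≢ p e∈Z))))
    where
    c : Point D
    c a = - χ (e ≟ a)
    c≢0 : c e ≢ 0ℚ
    c≢0 ce≡0 with trans (sym (cong -_ (χ-yes (e ≟ e) refl))) ce≡0
    ... | ()
    dot-c : ∀ x → dot D c x ≡ - x e
    dot-c x = begin
      dot D c x              ≡⟨ ∑-point e off ⟩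
      - χ (e ≟ e) * x e      ≡⟨ cong (λ r → - r * x e) (χ-yes (e ≟ e) refl) ⟩
      - 1ℚ * x e             ≡⟨ ℚ.neg-distribˡ-* 1ℚ (x e) ⟨
      - (1ℚ * x e)           ≡⟨ cong -_ (ℚ.*-identityˡ (x e)) ⟩
      - x e                  ∎
      where
      off : ∀ a → a ≢ e → c a * x a ≡ 0ℚ
      off a a≢e = trans (cong (λ r → - r * x a) (χ-no (e ≟ a) (a≢e ∘ sym))) (ℚ.*-zeroˡ (x a))
    valid : ∀ x → InFlowPolytope D x → dot D c x ≤ 0ℚ
    valid x (x≥0 , _) = subst (_≤ 0ℚ) (sym (dot-c x)) (ℚ.neg-antimono-≤ (x≥0 e))

  -- Corridors and facets

  Deg11 : Fin n → Set
  Deg11 w = InDeg1 D w × OutDeg1 D w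

  sole : ∀ {P : Fin m → Set} → ExactlyOne D P → ∀ {e} → P e → ∀ e′ → P e′ → e′ ≡ e
  sole (_ , _ , unique) pe e′ pe′ = trans (unique e′ pe′) (sym (unique _ pe))

  sole-or-another : ∀ {P : Fin m → Set} → Decidable P → ∀ {e} → P e →
                    (∀ e′ → P e′ → e′ ≡ e) ⊎ ∃ λ e′ → P e′ × e′ ≢ e
  sole-or-another P? {e} pe with any? (λ e′ → P? e′ ×-dec ¬? (e′ ≟ e))
  ... | yes (e′ , pe′ , e′≢e) = inj₂ (e′ , pe′ , e′≢e)
  ... | no  ∄ = inj₁ λ e′ pe′ → decidable-stable (e′ ≟ e) (λ e′≢e → ∄ (e′ , pe′ , e′≢e))

  exactlyOne? : ∀ {P : Fin m → Set} → Decidable P → Dec (ExactlyOne D P)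
  exactlyOne? P? with any? P?
  ... | no ∄ = no λ (e , pe , _) → ∄ (e , pe)
  ... | yes (e , pe) with sole-or-another P? pe
  ...   | inj₁ unique = yes (e , pe , unique)
  ...   | inj₂ (e′ , pe′ , e′≢e) = no λ one → e′≢e (sole one pe e′ pe′)

  deg11? : Decidable Deg11
  deg11? w = exactlyOne? (λ e → Ã? e ×-dec (hd e ≟ w)) ×-dec exactlyOne? (λ e → Ã? e ×-dec (tl e ≟ w))

  deg11-flow : ∀ {x} → InFlowPolytope D x → ∀ {w} → Deg11 w →
               ∀ {e e′} → Ã e → hd e ≡ w → Ã e′ → tl e′ ≡ w → x e ≡ x e′
  deg11-flow {x} x∈P {w} (in1 , out1) {e} {e′} ãe hd≡w ãe′ tl≡w = begin
    x e             ≡⟨ flow-through-sole-arc x∈P s⇝t hd (sole in1 (ãe , hd≡w)) hd≡w ⟨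
    inflow D x w    ≡⟨ conservation x∈P w≢s w≢t ⟨
    outflow D x w   ≡⟨ flow-through-sole-arc x∈P s⇝t tl (sole out1 (ãe′ , tl≡w)) tl≡w ⟩
    x e′            ∎
    where
    s⇝t = Ã⇒reach-st ãe
    w≢s : w ≢ s
    w≢s w≡s = Ã⇒hd≢s ãe (trans hd≡w w≡s)
    w≢t : w ≢ t
    w≢t w≡t = Ã⇒tl≢t ãe′ (trans tl≡w w≡t)

  record Segment (u v : Fin n) (C : List (Fin m)) : Set where
    constructor segment
    field
      walk     : W u v C
      nonempty : C ≢ []
      arcs-Ã   : All Ã C
      inner    : All Deg11 (interior D C)

  segment-flow : ∀ {x} → InFlowPolytope D x → ∀ {u v C} → Segment u v C →
                 ∀ {e e′} → e ∈ C → e′ ∈ C → x e ≡ x e′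
  segment-flow x∈P {C = []}    _ ()
  segment-flow {x} x∈P {C = _ ∷ _} (segment p _ ã inner) e∈C e′∈C =
    trans (to-first p ã inner e∈C) (sym (to-first p ã inner e′∈C))
    where
    to-first : ∀ {u v c cs e} → W u v (c ∷ cs) → All Ã (c ∷ cs) → All Deg11 (interior D (c ∷ cs)) →
               e ∈ c ∷ cs → x e ≡ x c
    to-first _ _ _ (here refl) = refl
    to-first {cs = []} _ _ _ (there ())
    to-first {cs = _ ∷ _} (_ ∷ tl≡ ∷ p) (ãc ∷ ãc′ ∷ ã) (d ∷ ds) (there e∈C) =
      trans (to-first (tl≡ ∷ p) (ãc′ ∷ ã) ds e∈C) (sym (deg11-flow x∈P d ãc refl ãc′ tl≡))

  segment-face-⊆ : ∀ {u v C} → Segment u v C → ∀ {e e′} → e ∈ C → e′ ∈ C →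
                   _⊆_ D (FaceOf D e) (FaceOf D e′)
  segment-face-⊆ seg e∈C e′∈C x (x∈P , xe≡0) =
    x∈P , trans (sym (segment-flow x∈P seg e∈C e′∈C)) xe≡0

  interior-∷ : ∀ {P : Fin n → Set} c {C} → C ≢ [] → P (hd c) → All P (interior D C) →
               All P (interior D (c ∷ C))
  interior-∷ c {[]}    C≢[] _   _  = ⊥-elim (C≢[] refl)
  interior-∷ c {_ ∷ _} _    phd pC = phd ∷ pC

  interior-∷ʳ : ∀ {P : Fin n → Set} c {u v C} → W u v C → C ≢ [] → All P (interior D C) → P v →
                All P (interior D (C ++ c ∷ []))
  interior-∷ʳ c []                C≢[] _         _  = ⊥-elim (C≢[] refl)
  interior-∷ʳ c (_ ∷ [])          _    _         pv = pv ∷ []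
  interior-∷ʳ c (_ ∷ p@(_ ∷ _))   _    (ph ∷ pC) pv = ph ∷ interior-∷ʳ c p (λ ()) pC pv

  -- The fuel k bounds the number of extensions, since a walk has fewer than n arcs.
  extend-forward : ∀ k {u v C e} → n ℕ.≤ length C ℕ.+ k → Segment u v C → e ∈ C →
                   ∃₂ λ v′ C′ → Segment u v′ C′ × e ∈ C′ × ¬ Deg11 v′
  extend-forward k {v = v} _ seg e∈C with deg11? v
  ... | no ¬d = _ , _ , seg , e∈C , ¬d
  extend-forward zero {C = C} n≤ (segment p _ _ _) _ | yes _ =
    ⊥-elim (ℕ.<⇒≱ (walk-length< p) (subst (n ℕ.≤_) (ℕ.+-identityʳ (length C)) n≤))
  extend-forward (suc k) {C = C} n≤ (segment p C≢[] ã inner) e∈C | yes d@(_ , c , (ãc , tl≡) , _) =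
    extend-forward k n≤′
      (segment (p ++ʷ (tl≡ ∷ [])) (C≢[] ∘ ++-conicalˡ C _)
               (All.++⁺ ã (ãc ∷ [])) (interior-∷ʳ c p C≢[] inner d))
      (∈-++⁺ˡ e∈C)
    where
    n≤′ : n ℕ.≤ length (C ++ c ∷ []) ℕ.+ k
    n≤′ = subst (n ℕ.≤_) (trans (sym (ℕ.+-assoc (length C) 1 k)) (cong (ℕ._+ k) (sym (length-++ C)))) n≤

  extend-backward : ∀ k {u v C e} → n ℕ.≤ length C ℕ.+ k → Segment u v C → e ∈ C →
                    ∃₂ λ u′ C′ → Segment u′ v C′ × e ∈ C′ × ¬ Deg11 u′
  extend-backward k {u = u} _ seg e∈C with deg11? u
  ... | no ¬d = _ , _ , seg , e∈C , ¬d
  extend-backward zero {C = C} n≤ (segment p _ _ _) _ | yes _ =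
    ⊥-elim (ℕ.<⇒≱ (walk-length< p) (subst (n ℕ.≤_) (ℕ.+-identityʳ (length C)) n≤))
  extend-backward (suc k) {C = C} n≤ (segment p C≢[] ã inner) e∈C | yes d@((c , (ãc , hd≡) , _) , _) =
    extend-backward k (subst (n ℕ.≤_) (ℕ.+-suc (length C) k) n≤)
      (segment (refl ∷ subst (λ w → W w _ C) (sym hd≡) p) (λ ())
               (ãc ∷ ã) (interior-∷ c C≢[] (subst Deg11 (sym hd≡) d) inner))
      (there e∈C)

  corridor-through : ∀ {a} → Ã a → ∃[ C ] (IsCorridor D C × a ∈ C)
  corridor-through {a} ãa
    with extend-forward n (ℕ.m≤n+m n 1) (segment (refl ∷ []) (λ ()) (ãa ∷ []) []) (here refl)
  ... | v , C , seg , a∈C , ¬dv with extend-backward n (ℕ.m≤n+m n (length C)) seg a∈C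
  ...   | u , C′ , segment p C′≢[] ã inner , a∈C′ , ¬du =
    C′ , (u , v , walk⇒path p , C′≢[] , ã , inner , ¬du , ¬dv) , a∈C′

  IsMaximal : (Point D → Set) → Set₁
  IsMaximal F = ∀ G → IsProperFace D G → _⊆_ D F G → _⊆_ D G F

  facet-maximal : ∀ {F G} → IsFacet D F → _≐_ D F G → IsMaximal G
  facet-maximal (_ , maximal) (F⊆G , G⊆F) H proper G⊆H x Hx =
    F⊆G x (maximal H proper (λ y Fy → G⊆H y (F⊆G y Fy)) x Hx)

  -- F_ℓ ⊆ F_c₁ by conservation at hd ℓ, so F_c₁ = F_ℓ by maximality; an s–t path through
  -- another leaving arc c₂ enters hd ℓ by ℓ, so it also contains c₁, which has the same tail.
  sole-in-arc⇒OutDeg1 : ∀ {ℓ} → IsMaximal (FaceOf D ℓ) → Ã ℓ →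
                        (∀ e → Ã e × hd e ≡ hd ℓ → e ≡ ℓ) → hd ℓ ≢ t → OutDeg1 D (hd ℓ)
  sole-in-arc⇒OutDeg1 {ℓ} maximal ãℓ sole-in hd≢t with Ã-successor ãℓ hd≢t
  ... | c₁ , ãc₁ , tl₁ = c₁ , (ãc₁ , tl₁) , out-unique
    where
    Fℓ⊆Fc₁ : _⊆_ D (FaceOf D ℓ) (FaceOf D c₁)
    Fℓ⊆Fc₁ x (x∈P , xℓ≡0) = x∈P , flowAt≡0⇒ (proj₁ x∈P) tl out≡0 tl₁
      where
      out≡0 : outflow D x (hd ℓ) ≡ 0ℚ
      out≡0 = begin
        outflow D x (hd ℓ)  ≡⟨ conservation x∈P (Ã⇒hd≢s ãℓ) hd≢t ⟩
        inflow D x (hd ℓ)   ≡⟨ flow-through-sole-arc x∈P (Ã⇒reach-st ãℓ) hd sole-in refl ⟩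
        x ℓ                 ≡⟨ xℓ≡0 ⟩
        0ℚ                  ∎

    out-unique : ∀ c₂ → Ã c₂ × tl c₂ ≡ hd ℓ → c₂ ≡ c₁
    out-unique c₂ (ãc₂ , tl₂) with Ã⇒reach ãc₂
    ... | (A , p) , (B , q) with last-arc p (λ s≡ → Ã⇒hd≢s ãℓ (trans (sym tl₂) (sym s≡)))
    ...   | e , e∈A , hd≡ = walk-tl-injective z (∈-++⁺ʳ A (here refl)) c₁∈Z (trans tl₂ (sym tl₁))
      where
      z = p ++ʷ (refl ∷ q)
      e∈Z = ∈-++⁺ˡ e∈A
      ℓ∈Z : ℓ ∈ A ++ c₂ ∷ B
      ℓ∈Z = subst (_∈ A ++ c₂ ∷ B) (sole-in e (st-walk⇒Ã z e∈Z , trans hd≡ tl₂)) e∈Z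
      c₁∈Z = face-⊆⇒∈ (maximal _ (FaceOf-proper ãc₁) Fℓ⊆Fc₁) z ℓ∈Z

  sole-out-arc⇒InDeg1 : ∀ {f} → IsMaximal (FaceOf D f) → Ã f →
                        (∀ e → Ã e × tl e ≡ tl f → e ≡ f) → tl f ≢ s → InDeg1 D (tl f)
  sole-out-arc⇒InDeg1 {f} maximal ãf sole-out tl≢s with Ã-predecessor ãf tl≢s
  ... | c₁ , ãc₁ , hd₁ = c₁ , (ãc₁ , hd₁) , in-unique
    where
    Ff⊆Fc₁ : _⊆_ D (FaceOf D f) (FaceOf D c₁)
    Ff⊆Fc₁ x (x∈P , xf≡0) = x∈P , flowAt≡0⇒ (proj₁ x∈P) hd in≡0 hd₁
      where
      in≡0 : inflow D x (tl f) ≡ 0ℚ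
      in≡0 = begin
        inflow D x (tl f)   ≡⟨ conservation x∈P tl≢s (Ã⇒tl≢t ãf) ⟨
        outflow D x (tl f)  ≡⟨ flow-through-sole-arc x∈P (Ã⇒reach-st ãf) tl sole-out refl ⟩
        x f                 ≡⟨ xf≡0 ⟩
        0ℚ                  ∎

    in-unique : ∀ c₂ → Ã c₂ × hd c₂ ≡ tl f → c₂ ≡ c₁
    in-unique c₂ (ãc₂ , hd₂) with Ã⇒reach ãc₂
    ... | (A , p) , (B , q) with first-arc q (λ ≡t → Ã⇒tl≢t ãf (trans (sym hd₂) ≡t))
    ...   | e , e∈B , tl≡ = walk-hd-injective z (∈-++⁺ʳ A (here refl)) c₁∈Z (trans hd₂ (sym hd₁))
      where
      z = p ++ʷ (refl ∷ q)
      e∈Z = ∈-++⁺ʳ A (there e∈B)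
      f∈Z : f ∈ A ++ c₂ ∷ B
      f∈Z = subst (_∈ A ++ c₂ ∷ B) (sole-out e (st-walk⇒Ã z e∈Z , trans tl≡ hd₂)) e∈Z
      c₁∈Z = face-⊆⇒∈ (maximal _ (FaceOf-proper ãc₁) Ff⊆Fc₁) z f∈Z

  another-in-arc : ∀ {ℓ} → IsMaximal (FaceOf D ℓ) → Ã ℓ → ¬ Deg11 (hd ℓ) → hd ℓ ≢ t →
                   ∃ λ a → (Ã a × hd a ≡ hd ℓ) × a ≢ ℓ
  another-in-arc {ℓ} maximal ãℓ ¬d hd≢t
    with sole-or-another (λ e → Ã? e ×-dec (hd e ≟ hd ℓ)) (ãℓ , refl)
  ... | inj₂ other   = other
  ... | inj₁ sole-in =
    ⊥-elim (¬d ((ℓ , (ãℓ , refl) , sole-in) , sole-in-arc⇒OutDeg1 maximal ãℓ sole-in hd≢t))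

  another-out-arc : ∀ {f} → IsMaximal (FaceOf D f) → Ã f → ¬ Deg11 (tl f) → tl f ≢ s →
                    ∃ λ a → (Ã a × tl a ≡ tl f) × a ≢ f
  another-out-arc {f} maximal ãf ¬d tl≢s
    with sole-or-another (λ e → Ã? e ×-dec (tl e ≟ tl f)) (ãf , refl)
  ... | inj₂ other    = other
  ... | inj₁ sole-out =
    ⊥-elim (¬d (sole-out-arc⇒InDeg1 maximal ãf sole-out tl≢s , (f , (ãf , refl) , sole-out)))

  ∉-after : ∀ {ℓ b Y} → IsMaximal (FaceOf D ℓ) → _⊆_ D (FaceOf D ℓ) (FaceOf D b) → Ã ℓ →
            ¬ Deg11 (hd ℓ) → W (hd ℓ) t Y → b ∉ Y
  ∉-after {ℓ} {b} {Y} maximal Fℓ⊆Fb ãℓ ¬d y b∈Y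
    with another-in-arc maximal ãℓ ¬d (walk-≢ y b∈Y)
  ... | a , (ãa , hd≡) , a≢ℓ with proj₁ (Ã⇒reach ãa)
  ...   | A , p = a≢ℓ (walk-hd-injective z (∈-++⁺ʳ A (here refl)) ℓ∈Z hd≡)
    where
    z = p ++ʷ (refl ∷ subst (λ w → W w t Y) (sym hd≡) y)
    ℓ∈Z = face-⊆⇒∈ Fℓ⊆Fb z (∈-++⁺ʳ A (there b∈Y))

  ∉-before : ∀ {f b X} → IsMaximal (FaceOf D f) → _⊆_ D (FaceOf D f) (FaceOf D b) → Ã f →
             ¬ Deg11 (tl f) → W s (tl f) X → b ∉ X
  ∉-before {f} {b} {X} maximal Ff⊆Fb ãf ¬d x b∈X
    with another-out-arc maximal ãf ¬d (walk-≢ x b∈X ∘ sym)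
  ... | a , (ãa , tl≡) , a≢f with proj₂ (Ã⇒reach ãa)
  ...   | B , q = a≢f (walk-tl-injective z (∈-++⁺ʳ X (here refl)) f∈Z tl≡)
    where
    z = x ++ʷ (tl≡ ∷ q)
    f∈Z = face-⊆⇒∈ Ff⊆Fb z (∈-++⁺ˡ b∈X)

  ∈-corridor : ∀ {a b u v C} →
               (∀ {e} → e ∈ C → IsMaximal (FaceOf D e) × _⊆_ D (FaceOf D e) (FaceOf D b)) →
               _⊆_ D (FaceOf D b) (FaceOf D a) →
               W u v C → All Ã C → ¬ Deg11 u → ¬ Deg11 v → a ∈ C → b ∈ C
  ∈-corridor {C = C} facets Fb⊆Fa c ã ¬du ¬dv a∈C
    with first-arc c (walk-≢ c a∈C) | last-arc c (walk-≢ c a∈C)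
  ... | f , f∈C , refl | ℓ , ℓ∈C , refl
    with proj₁ (Ã⇒reach (All.lookup ã f∈C)) | proj₂ (Ã⇒reach (All.lookup ã ℓ∈C))
  ... | X , x | Y , y with ∈-++⁻ X (face-⊆⇒∈ Fb⊆Fa (x ++ʷ (c ++ʷ y)) (∈-++⁺ʳ X (∈-++⁺ˡ a∈C)))
  ... | inj₁ b∈X  =
    ⊥-elim (∉-before (proj₁ (facets f∈C)) (proj₂ (facets f∈C)) (All.lookup ã f∈C) ¬du x b∈X)
  ... | inj₂ b∈CY with ∈-++⁻ C b∈CY
  ...   | inj₁ b∈C = b∈C
  ...   | inj₂ b∈Y =
    ⊥-elim (∉-after (proj₁ (facets ℓ∈C)) (proj₂ (facets ℓ∈C)) (All.lookup ã ℓ∈C) ¬dv y b∈Y)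

  corridor-∋ : ∀ {a b C} → IsFacet D (FaceOf D a) → _≐_ D (FaceOf D a) (FaceOf D b) →
               IsCorridor D C → a ∈ C → b ∈ C
  corridor-∋ {a} {b} facet (Fa⊆Fb , Fb⊆Fa) (_ , _ , (c , _) , C≢[] , ã , inner , ¬du , ¬dv) a∈C =
    ∈-corridor facets Fb⊆Fa c ã ¬du ¬dv a∈C
    where
    seg = segment c C≢[] ã inner
    facets : ∀ {e} → e ∈ _ → IsMaximal (FaceOf D e) × _⊆_ D (FaceOf D e) (FaceOf D b)
    facets e∈C = facet-maximal facet (segment-face-⊆ seg a∈C e∈C , segment-face-⊆ seg e∈C a∈C)
               , λ x Fe → Fa⊆Fb x (segment-face-⊆ seg e∈C a∈C x Fe)

  same-corridor⇒face-≐ : ∀ {a b} → SameCorridor D a b → _≐_ D (FaceOf D a) (FaceOf D b)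
  same-corridor⇒face-≐ (_ , (_ , _ , (c , _) , C≢[] , ã , inner , _) , a∈C , b∈C) =
    segment-face-⊆ seg a∈C b∈C , segment-face-⊆ seg b∈C a∈C
    where seg = segment c C≢[] ã inner

lemma3 : (D : Network) (a b : Fin (Network.m D))
    → InÃ D a → InÃ D b
    → IsFacet D (FaceOf D a) → IsFacet D (FaceOf D b)
    → (_≐_ D (FaceOf D a) (FaceOf D b)) ⇔ SameCorridor D a b
lemma3 D a b ãa _ facet _ = mk⇔ same-corridor (same-corridor⇒face-≐ D)
  where
  same-corridor : _≐_ D (FaceOf D a) (FaceOf D b) → SameCorridor D a b
  same-corridor Fa≐Fb with corridor-through D ãa
  ... | C , corridor , a∈C = C , corridor , a∈C , corridor-∋ D facet Fa≐Fb corridor a∈C
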